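{- Let $G$ be a connected unit interval graph on $n$ vertices with lower bounds $\mathrm{lbound}:V(G)\to\mathbb{Q}\cup\{ -\infty\}$ (finite for at least one vertex). Let $\varepsilon=1/K$ with $K\ge n$ an integer, fix a partial order $<$ on $V(G)$ as in the context, and let $\mathcal{R}=(\ell_v)\in\mathfrak{Rep}$. Then $\mathcal{R}$ is the left-most representation of $\mathfrak{Rep}$ if and only if there is no vertex $u$ such that the assignment obtained from $\mathcal{R}$ by replacing $\ell_u$ with $\ell_u-\varepsilon$ (keeping all other positions) again belongs to $\mathfrak{Rep}$.
   Context: A unit interval representation of $G$ is an assignment of reals $\ell_v$ such that $uv\in E(G)$ iff $|\ell_u-\ell_v|\le 1$; it is an $\varepsilon$-grid representation if every $\ell_v$ is an integer multiple of $\varepsilon$. Vertices $u,v$ are indistinguishable if $N[u]=N[v]$. The partial order $<$ is fixed so that distinct vertices are comparable iff they are not indistinguishable, and $<$ is the left-to-right order of the intervals of some unit interval representation of $G$. $\mathfrak{Rep}$ is the set of all $\varepsilon$-grid representations of $G$ with $\ell_u<\ell_v$ whenever $u<v$ and $\ell_v\ge\mathrm{lbound}(v)$ for all $v$, ordered by $\mathcal{R}\le\mathcal{R}'$ iff $\ell_v\le\ell'_v$ for all $v$. The left-most representation is the $\mathcal{R}\in\mathfrak{Rep}$ with $\mathcal{R}\le\mathcal{R}'$ for every $\mathcal{R}'\in\mathfrak{Rep}$. -}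

module Defs where

open import Data.Nat.Base as ℕ using (ℕ; NonZero)
open import Data.Fin.Base using (Fin)
open import Data.Fin.Properties using (_≟_)
open import Data.Integer.Base using (ℤ; +_)
open import Data.Rational.Base using (ℚ; _≤_; _<_; _-_; _*_; ∣_∣; 1ℚ; _/_)
open import Data.Maybe.Base using (Maybe; just; nothing)
open import Data.Product.Base using (Σ; ∃; ∃-syntax; _×_; _,_)
open import Data.Sum.Base using (_⊎_)
open import Data.Unit.Base using (⊤)
open import Function.Bundles using (_⇔_)
open import Relation.Nullary using (¬_; yes; no)
open import Relation.Binary.PropositionalEquality using (_≡_; _≢_)
open import Relation.Binary.Structures using (IsStrictPartialOrder)

record Graph (n : ℕ) : Set₁ where
  field
    E      : Fin n → Fin n → Set
    irrefl : ∀ u → ¬ E u u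
    sym    : ∀ {u v} → E u v → E v u
open Graph public

data Reach {n : ℕ} (G : Graph n) : Fin n → Fin n → Set where
  here : ∀ {u} → Reach G u u
  step : ∀ {u v w} → E G u v → Reach G v w → Reach G u w

Connected : ∀ {n} → Graph n → Set
Connected G = ∀ u v → Reach G u v

IsUnitIntervalRep : ∀ {n} → Graph n → (Fin n → ℚ) → Set
IsUnitIntervalRep G ℓ = ∀ u v → u ≢ v → (E G u v ⇔ (∣ ℓ u - ℓ v ∣ ≤ 1ℚ))

InClosedNbhd : ∀ {n} → Graph n → Fin n → Fin n → Set
InClosedNbhd G u w = (w ≡ u) ⊎ E G u w

Indistinguishable : ∀ {n} → Graph n → Fin n → Fin n → Set
Indistinguishable G u v = ∀ w → (InClosedNbhd G u w ⇔ InClosedNbhd G v w)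

record AdmissibleOrder {n} (G : Graph n) (_≺_ : Fin n → Fin n → Set) : Set where
  field
    isSPO      : IsStrictPartialOrder _≡_ _≺_
    comparable : ∀ u v → u ≢ v → ((u ≺ v ⊎ v ≺ u) ⇔ (¬ Indistinguishable G u v))
    witness    : Σ (Fin n → ℚ) λ ℓ →
                   IsUnitIntervalRep G ℓ × (∀ u v → u ≺ v → ℓ u < ℓ v)

-- Lower bounds: nothing stands for -∞.
AboveLB : Maybe ℚ → ℚ → Set
AboveLB nothing  x = ⊤
AboveLB (just b) x = b ≤ x

ε : (K : ℕ) → .{{_ : NonZero K}} → ℚ
ε K = (+ 1) / K

OnGrid : (K : ℕ) → .{{_ : NonZero K}} → ℚ → Set
OnGrid K x = ∃[ k ] x ≡ (k / 1) * ε K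

InRep : ∀ {n} (G : Graph n) (_≺_ : Fin n → Fin n → Set) (lbound : Fin n → Maybe ℚ)
        (K : ℕ) → .{{_ : NonZero K}} → (Fin n → ℚ) → Set
InRep G _≺_ lbound K ℓ =
  IsUnitIntervalRep G ℓ
  × (∀ v → OnGrid K (ℓ v))
  × (∀ u v → u ≺ v → ℓ u < ℓ v)
  × (∀ v → AboveLB (lbound v) (ℓ v))

_≤R_ : ∀ {n} → (Fin n → ℚ) → (Fin n → ℚ) → Set
ℓ ≤R ℓ' = ∀ v → ℓ v ≤ ℓ' v

IsLeftmost : ∀ {n} (G : Graph n) (_≺_ : Fin n → Fin n → Set) (lbound : Fin n → Maybe ℚ)
             (K : ℕ) → .{{_ : NonZero K}} → (Fin n → ℚ) → Set
IsLeftmost G _≺_ lbound K ℓ =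
  InRep G _≺_ lbound K ℓ × (∀ ℓ' → InRep G _≺_ lbound K ℓ' → ℓ ≤R ℓ')

shiftLeft : ∀ {n} (K : ℕ) → .{{_ : NonZero K}} → (Fin n → ℚ) → Fin n → (Fin n → ℚ)
shiftLeft K ℓ u v with v ≟ u
... | yes _ = ℓ u - ε K
... | no  _ = ℓ v

module Submission where

-- Write ℓ = X / K with X integral. If no vertex can be moved one grid step to the left, every vertex
-- u has a blocker w: moving u would break the edge uw (X w = X u + K), make u collide with a
-- predecessor w (X w = X u - 1), or create the edge uw (X w = X u - 1 - K). If another
-- representation Y lies strictly left of X at some vertex, every blocker of such a vertex does too,
-- so following blockers closes a cycle of at most n ≤ K such jumps. Jumps of +K, -1 and -(K + 1)
-- cannot sum to zero in fewer than K + 1 steps.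

open import Defs hiding (sym; irrefl)
open import Data.Nat.Base as ℕ using (ℕ; zero; suc; NonZero)
import Data.Nat.Properties as ℕ
open import Data.Nat.GeneralisedArithmetic using (iterate)
open import Data.Integer.Base as ℤ using (ℤ; +_; -_; _+_; _-_; _*_; pred)
import Data.Integer.Properties as ℤ
open import Data.Integer.Tactic.RingSolver using (solve-∀)
open import Algebra.Bundles using (AbelianGroup)
open import Data.Fin.Base as Fin using (Fin; toℕ)
open import Data.Fin.Properties using (pigeonhole; toℕ<n; _≟_; ∀-cons)
open import Data.Rational.Base as ℚ using (ℚ; _/_; 1ℚ; toℚᵘ)
import Data.Rational.Properties as ℚ
open import Data.Rational.Unnormalised.Base as ℚᵘ using (mkℚᵘ; *≡*; *≤*; *<*)
import Data.Rational.Unnormalised.Properties as ℚᵘ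
open import Data.Maybe.Base using (Maybe; just; nothing)
open import Data.Product.Base using (Σ; ∃; ∃-syntax; _×_; _,_; proj₁; proj₂; swap)
open import Data.Sum.Base using (_⊎_; inj₁; inj₂; [_,_]′)
open import Function.Bundles using (_⇔_; mk⇔; Equivalence)
import Function.Properties.Equivalence as ⇔
open import Relation.Nullary using (¬_; contradiction; yes; no)
open import Relation.Binary.Structures using (IsStrictPartialOrder)
open import Relation.Binary.PropositionalEquality
  using (_≡_; _≢_; refl; sym; trans; cong; cong₂; subst; subst₂; module ≡-Reasoning)

open import Algebra.Properties.Group (AbelianGroup.group ℤ.+-0-abelianGroup) using (∙-cancelˡ)

data Walk {A : Set} (R : A → A → Set) : ℕ → A → A → Set where
  []  : ∀ {a} → Walk R 0 a a
  _∷_ : ∀ {L a b c} → R a b → Walk R L b c → Walk R (suc L) a c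

Walk-map : ∀ {A B : Set} {R : A → A → Set} {S : B → B → Set} (f : A → B) →
           (∀ {a b} → R a b → S (f a) (f b)) → ∀ {L a b} → Walk R L a b → Walk S L (f a) (f b)
Walk-map f g []       = []
Walk-map f g (r ∷ rs) = g r ∷ Walk-map f g rs

iterate-+ : ∀ {A : Set} (f : A → A) x i j → iterate f x (i ℕ.+ j) ≡ iterate f (iterate f x i) j
iterate-+ f x zero    j = refl
iterate-+ f x (suc i) j = iterate-+ f (f x) i j

module _ {n} {P : Fin n → Set} {R : Fin n → Fin n → Set}
         (next : ∀ {u} → P u → ∃[ w ] R u w × P w) where

  private
    advance : Σ (Fin n) P → Σ (Fin n) P
    advance (u , pu) = proj₁ (next pu) , proj₂ (proj₂ (next pu))

    walk : ∀ L p → Walk R L (proj₁ p) (proj₁ (iterate advance p L))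
    walk zero    p        = []
    walk (suc L) (u , pu) = proj₁ (proj₂ (next pu)) ∷ walk L (advance (u , pu))

  successor-closed⇒short-cycle : ∀ {v} → P v → ∃[ s ] ∃[ L ] 0 ℕ.< L × L ℕ.≤ n × Walk R L s s
  successor-closed⇒short-cycle {v} pv
    with i , j , i<j , same ← pigeonhole (ℕ.n<1+n n) (λ i → proj₁ (iterate advance (v , pv) (toℕ i)))
    = proj₁ q , L , ℕ.m<n⇒0<n∸m i<j , L≤n , subst (Walk R L (proj₁ q)) returns (walk L q)
    where
    q : Σ (Fin n) P
    q = iterate advance (v , pv) (toℕ i)
    L : ℕ
    L = toℕ j ℕ.∸ toℕ i
    L≤n : L ℕ.≤ n
    L≤n = ℕ.≤-trans (ℕ.m∸n≤m (toℕ j) (toℕ i)) (ℕ.s≤s⁻¹ (toℕ<n j))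
    returns : proj₁ (iterate advance q L) ≡ proj₁ q
    returns = begin
      proj₁ (iterate advance q L)                      ≡⟨ cong proj₁ (iterate-+ advance (v , pv) (toℕ i) L) ⟨
      proj₁ (iterate advance (v , pv) (toℕ i ℕ.+ L))   ≡⟨ cong (λ m → proj₁ (iterate advance (v , pv) m)) (ℕ.m+[n∸m]≡n (ℕ.<⇒≤ i<j)) ⟩
      proj₁ (iterate advance (v , pv) (toℕ j))         ≡⟨ same ⟨
      proj₁ q                                          ∎
      where open ≡-Reasoning

data Jump (K : ℕ) (x y : ℤ) : Set where
  up   : y ≡ x + + K → Jump K x y
  down : y ≡ pred x → Jump K x y
  leap : y + + K ≡ pred x → Jump K x y

-- y - x = ups * K - downs - leaps * (K + 1), with the negative terms moved to the left.
record Tally (K L : ℕ) (x y : ℤ) : Set where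
  field
    ups downs leaps : ℕ
    total   : ups ℕ.+ downs ℕ.+ leaps ≡ L
    balance : y + (+ downs + + leaps * + suc K) ≡ x + + ups * + K

tally-cons : ∀ {K L x y z} → Jump K x y → Tally K L y z → Tally K (suc L) x z
tally-cons {K} {x = x} {y} {z} (up y≡x+K) t = record
  { ups = suc ups ; downs = downs ; leaps = leaps
  ; total = cong suc total
  ; balance = begin
      z + (+ downs + + leaps * + suc K) ≡⟨ balance ⟩
      y + + ups * + K                   ≡⟨ cong (λ y → y + + ups * + K) y≡x+K ⟩
      x + + K + + ups * + K             ≡⟨ regroup x (+ K) (+ ups) ⟩
      x + + suc ups * + K               ∎ }
  where
  open Tally t
  open ≡-Reasoning
  regroup : ∀ x k a → x + k + a * k ≡ x + (+ 1 + a) * k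
  regroup = solve-∀
tally-cons {K} {x = x} {y} {z} (down y≡pred[x]) t = record
  { ups = ups ; downs = suc downs ; leaps = leaps
  ; total = trans (cong (ℕ._+ leaps) (ℕ.+-suc ups downs)) (cong suc total)
  ; balance = begin
      z + (+ suc downs + + leaps * + suc K)   ≡⟨ split z (+ downs) (+ leaps * + suc K) ⟩
      z + (+ downs + + leaps * + suc K) + + 1 ≡⟨ cong (_+ + 1) balance ⟩
      y + + ups * + K + + 1                   ≡⟨ cong (λ y → y + + ups * + K + + 1) y≡pred[x] ⟩
      pred x + + ups * + K + + 1              ≡⟨ cancel x (+ ups * + K) ⟩
      x + + ups * + K                         ∎ }
  where
  open Tally t
  open ≡-Reasoning
  split : ∀ z b c → z + ((+ 1 + b) + c) ≡ z + (b + c) + + 1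
  split = solve-∀
  cancel : ∀ x a → (- + 1 + x) + a + + 1 ≡ x + a
  cancel = solve-∀
tally-cons {K} {x = x} {y} {z} (leap y+K≡pred[x]) t = record
  { ups = ups ; downs = downs ; leaps = suc leaps
  ; total = trans (ℕ.+-suc (ups ℕ.+ downs) leaps) (cong suc total)
  ; balance = begin
      z + (+ downs + + suc leaps * + suc K)           ≡⟨ split z (+ downs) (+ leaps) (+ K) ⟩
      z + (+ downs + + leaps * + suc K) + + suc K     ≡⟨ cong (_+ + suc K) balance ⟩
      y + + ups * + K + + suc K                       ≡⟨ regroup y (+ ups * + K) (+ K) ⟩
      y + + K + + ups * + K + + 1                     ≡⟨ cong (λ t → t + + ups * + K + + 1) y+K≡pred[x] ⟩
      pred x + + ups * + K + + 1                      ≡⟨ cancel x (+ ups * + K) ⟩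
      x + + ups * + K                                 ∎ }
  where
  open Tally t
  open ≡-Reasoning
  split : ∀ z b c k → z + (b + (+ 1 + c) * (+ 1 + k)) ≡ z + (b + c * (+ 1 + k)) + (+ 1 + k)
  split = solve-∀
  regroup : ∀ y a k → y + a + (+ 1 + k) ≡ y + k + a + + 1
  regroup = solve-∀
  cancel : ∀ x a → (- + 1 + x) + a + + 1 ≡ x + a
  cancel = solve-∀

tally : ∀ {K L x y} → Walk (Jump K) L x y → Tally K L x y
tally {K} {x = x} [] = record
  { ups = 0 ; downs = 0 ; leaps = 0 ; total = refl ; balance = stay x (+ K) }
  where
  stay : ∀ x k → x + (+ 0 + + 0 * (+ 1 + k)) ≡ x + + 0 * k
  stay = solve-∀
tally (j ∷ js) = tally-cons j (tally js)

-- If a ≤ c the left-hand side exceeds a K unless a = b = c = 0; if c < a then b + c = (a - c) K ≥ K.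
balanced⇒long : ∀ K a b c → 0 ℕ.< a ℕ.+ b ℕ.+ c →
                b ℕ.+ c ℕ.* suc K ≡ a ℕ.* K → K ℕ.< a ℕ.+ b ℕ.+ c
balanced⇒long K a b c 0<abc balance = [ a≤c⇒long , c<a⇒long ]′ (ℕ.≤-<-connex a c)
  where
  open ℕ.≤-Reasoning
  balance′ : b ℕ.+ c ℕ.+ c ℕ.* K ≡ a ℕ.* K
  balance′ = trans (trans (ℕ.+-assoc b c (c ℕ.* K)) (cong (b ℕ.+_) (sym (ℕ.*-suc c K)))) balance

  a≤c⇒long : a ℕ.≤ c → K ℕ.< a ℕ.+ b ℕ.+ c
  a≤c⇒long a≤c = contradiction 0<abc (ℕ.≤⇒≯ (begin
    a ℕ.+ b ℕ.+ c           ≡⟨ ℕ.+-assoc a b c ⟩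
    a ℕ.+ (b ℕ.+ c)         ≤⟨ ℕ.+-monoˡ-≤ (b ℕ.+ c) (ℕ.≤-trans a≤c (ℕ.m≤n+m c b)) ⟩
    (b ℕ.+ c) ℕ.+ (b ℕ.+ c) ≡⟨ cong₂ ℕ._+_ b+c≡0 b+c≡0 ⟩
    0                       ∎))
    where
    b+c≡0 : b ℕ.+ c ≡ 0
    b+c≡0 = ℕ.n≤0⇒n≡0 (ℕ.+-cancelʳ-≤ (c ℕ.* K) (b ℕ.+ c) 0 (begin
      b ℕ.+ c ℕ.+ c ℕ.* K ≡⟨ balance′ ⟩
      a ℕ.* K             ≤⟨ ℕ.*-monoˡ-≤ K a≤c ⟩
      c ℕ.* K             ∎))

  c<a⇒long : c ℕ.< a → K ℕ.< a ℕ.+ b ℕ.+ c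
  c<a⇒long c<a = begin-strict
    K               <⟨ ℕ.s≤s K≤b+c ⟩
    suc (b ℕ.+ c)   ≤⟨ ℕ.+-monoˡ-≤ (b ℕ.+ c) (ℕ.≤-trans (ℕ.s≤s ℕ.z≤n) c<a) ⟩
    a ℕ.+ (b ℕ.+ c) ≡⟨ ℕ.+-assoc a b c ⟨
    a ℕ.+ b ℕ.+ c   ∎
    where
    K≤b+c : K ℕ.≤ b ℕ.+ c
    K≤b+c = ℕ.+-cancelʳ-≤ (c ℕ.* K) K (b ℕ.+ c) (begin
      suc c ℕ.* K         ≤⟨ ℕ.*-monoˡ-≤ K c<a ⟩
      a ℕ.* K             ≡⟨ balance′ ⟨
      b ℕ.+ c ℕ.+ c ℕ.* K ∎)

jump-cycle-long : ∀ {K L x} → 0 ℕ.< L → Walk (Jump K) L x x → K ℕ.< L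
jump-cycle-long {K} {L} {x} 0<L js =
  subst (K ℕ.<_) total (balanced⇒long K ups downs leaps (subst (0 ℕ.<_) (sym total) 0<L) balanceℕ)
  where
  open Tally (tally js)
  balanceℕ : downs ℕ.+ leaps ℕ.* suc K ≡ ups ℕ.* K
  balanceℕ = ℤ.+-injective (begin
    + (downs ℕ.+ leaps ℕ.* suc K)   ≡⟨ ℤ.pos-+ downs (leaps ℕ.* suc K) ⟩
    + downs + + (leaps ℕ.* suc K)   ≡⟨ cong (λ t → + downs + t) (ℤ.pos-* leaps (suc K)) ⟩
    + downs + + leaps * + suc K     ≡⟨ ∙-cancelˡ x _ _ balance ⟩
    + ups * + K                     ≡⟨ ℤ.pos-* ups K ⟨
    + (ups ℕ.* K)                   ∎)
    where open ≡-Reasoning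

Near : ℕ → ℤ → ℤ → Set
Near K x y = x ℤ.≤ y + + K × y ℤ.≤ x + + K

i-j≤k⇔i≤j+k : ∀ i j k → i - j ℤ.≤ k ⇔ i ℤ.≤ j + k
i-j≤k⇔i≤j+k i j k = mk⇔
  (λ i-j≤k → subst₂ ℤ._≤_ (restore i j) (ℤ.+-comm k j) (ℤ.+-monoˡ-≤ j i-j≤k))
  (λ i≤j+k → subst (i - j ℤ.≤_) (cancel j k) (ℤ.+-monoˡ-≤ (- j) i≤j+k))
  where
  restore : ∀ i j → i - j + j ≡ i
  restore = solve-∀
  cancel : ∀ j k → j + k - j ≡ k
  cancel = solve-∀

∣-∣≤⇔≤+ : ∀ K {x y} → x ℤ.≤ y → ℤ.∣ x - y ∣ ℕ.≤ K ⇔ y ℤ.≤ x + + K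
∣-∣≤⇔≤+ K {x} {y} x≤y = mk⇔
  (λ ∣x-y∣≤K → Equivalence.to (i-j≤k⇔i≤j+k y x (+ K)) (subst (ℤ._≤ + K) ∣x-y∣≡y-x (ℤ.+≤+ ∣x-y∣≤K)))
  (λ y≤x+K → ℤ.drop‿+≤+ (subst (ℤ._≤ + K) (sym ∣x-y∣≡y-x) (Equivalence.from (i-j≤k⇔i≤j+k y x (+ K)) y≤x+K)))
  where
  ∣x-y∣≡y-x : + ℤ.∣ x - y ∣ ≡ y - x
  ∣x-y∣≡y-x = ℤ.∣-∣-≤ x≤y

∣-∣≤⇔Near : ∀ K x y → ℤ.∣ x - y ∣ ℕ.≤ K ⇔ Near K x y
∣-∣≤⇔Near K x y with ℤ.≤-total x y
... | inj₁ x≤y = mk⇔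
  (λ ∣x-y∣≤K → ℤ.≤-trans x≤y (ℤ.i≤i+j y (+ K)) , Equivalence.to (∣-∣≤⇔≤+ K x≤y) ∣x-y∣≤K)
  (λ (_ , y≤x+K) → Equivalence.from (∣-∣≤⇔≤+ K x≤y) y≤x+K)
... | inj₂ y≤x = mk⇔
  (λ ∣x-y∣≤K → Equivalence.to (∣-∣≤⇔≤+ K y≤x) (subst (ℕ._≤ K) (ℤ.∣i-j∣≡∣j-i∣ x y) ∣x-y∣≤K)
             , ℤ.≤-trans y≤x (ℤ.i≤i+j x (+ K)))
  (λ (x≤y+K , _) → subst (ℕ._≤ K) (ℤ.∣i-j∣≡∣j-i∣ y x) (Equivalence.from (∣-∣≤⇔≤+ K y≤x) x≤y+K))


module Grid (k : ℕ) where

  open import Data.Integer.Base using (_≤_; _<_)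

  grid : ℤ → ℚ
  grid i = i / suc k

  toℚᵘ-grid : ∀ i → toℚᵘ (grid i) ℚᵘ.≃ mkℚᵘ i k
  toℚᵘ-grid i = ℚ.toℚᵘ-fromℚᵘ (mkℚᵘ i k)

  grid-mono-≤ : ∀ {i j} → i ≤ j → grid i ℚ.≤ grid j
  grid-mono-≤ {i} {j} i≤j = ℚ.toℚᵘ-cancel-≤
    (ℚᵘ.≤-respˡ-≃ (ℚᵘ.≃-sym (toℚᵘ-grid i)) (ℚᵘ.≤-respʳ-≃ (ℚᵘ.≃-sym (toℚᵘ-grid j))
      (*≤* (ℤ.*-monoʳ-≤-nonNeg (+ suc k) i≤j))))

  grid-cancel-≤ : ∀ {i j} → grid i ℚ.≤ grid j → i ≤ j
  grid-cancel-≤ {i} {j} gi≤gj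
    with ℚᵘ.≤-respˡ-≃ (toℚᵘ-grid i) (ℚᵘ.≤-respʳ-≃ (toℚᵘ-grid j) (ℚ.toℚᵘ-mono-≤ gi≤gj))
  ... | *≤* i*K≤j*K = ℤ.*-cancelʳ-≤-pos i j (+ suc k) i*K≤j*K

  grid-mono-< : ∀ {i j} → i < j → grid i ℚ.< grid j
  grid-mono-< {i} {j} i<j = ℚ.toℚᵘ-cancel-<
    (ℚᵘ.<-respˡ-≃ (ℚᵘ.≃-sym (toℚᵘ-grid i)) (ℚᵘ.<-respʳ-≃ (ℚᵘ.≃-sym (toℚᵘ-grid j))
      (*<* (ℤ.*-monoʳ-<-pos (+ suc k) i<j))))

  grid-cancel-< : ∀ {i j} → grid i ℚ.< grid j → i < j
  grid-cancel-< {i} {j} gi<gj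
    with ℚᵘ.<-respˡ-≃ (toℚᵘ-grid i) (ℚᵘ.<-respʳ-≃ (toℚᵘ-grid j) (ℚ.toℚᵘ-mono-< gi<gj))
  ... | *<* i*K<j*K = ℤ.*-cancelʳ-<-nonNeg (+ suc k) i*K<j*K

  grid-homo-sub : ∀ i j → grid i ℚ.- grid j ≡ grid (i - j)
  grid-homo-sub i j = ℚ.toℚᵘ-injective (begin
    toℚᵘ (grid i ℚ.- grid j)                 ≈⟨ ℚ.toℚᵘ-homo-+ (grid i) (ℚ.- grid j) ⟩
    toℚᵘ (grid i) ℚᵘ.+ toℚᵘ (ℚ.- grid j)     ≈⟨ ℚᵘ.+-cong (toℚᵘ-grid i) (ℚᵘ.≃-trans (ℚ.toℚᵘ-homo‿- (grid j)) (ℚᵘ.-‿cong (toℚᵘ-grid j))) ⟩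
    mkℚᵘ i k ℚᵘ.+ ℚᵘ.- mkℚᵘ j k             ≈⟨ *≡* (common-denominator i j (+ suc k)) ⟩
    mkℚᵘ (i - j) k                           ≈⟨ toℚᵘ-grid (i - j) ⟨
    toℚᵘ (grid (i - j))                      ∎)
    where
    open ℚᵘ.≃-Reasoning
    common-denominator : ∀ i j d → (i * d + - j * d) * d ≡ (i - j) * (d * d)
    common-denominator = solve-∀

  ∣grid∣ : ∀ i → ℚ.∣ grid i ∣ ≡ grid (+ ℤ.∣ i ∣)
  ∣grid∣ i = ℚ.toℚᵘ-injective (ℚᵘ.≃-trans (ℚ.toℚᵘ-homo-∣-∣ (grid i))
    (ℚᵘ.≃-trans (ℚᵘ.∣-∣-cong (toℚᵘ-grid i)) (ℚᵘ.≃-sym (toℚᵘ-grid (+ ℤ.∣ i ∣)))))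

  grid-K≡1 : grid (+ suc k) ≡ 1ℚ
  grid-K≡1 = ℚ.toℚᵘ-injective (ℚᵘ.≃-trans (toℚᵘ-grid (+ suc k)) (*≡* (cong +_ (ℕ.*-comm (suc k) 1))))

  ε-multiple≡grid : ∀ i → (i / 1) ℚ.* ε (suc k) ≡ grid i
  ε-multiple≡grid i = ℚ.toℚᵘ-injective (begin
    toℚᵘ ((i / 1) ℚ.* ε (suc k))         ≈⟨ ℚ.toℚᵘ-homo-* (i / 1) (ε (suc k)) ⟩
    toℚᵘ (i / 1) ℚᵘ.* toℚᵘ (ε (suc k))   ≈⟨ ℚᵘ.*-cong (ℚ.toℚᵘ-fromℚᵘ (mkℚᵘ i 0)) (toℚᵘ-grid (+ 1)) ⟩
    mkℚᵘ i 0 ℚᵘ.* mkℚᵘ (+ 1) k            ≈⟨ *≡* (rescale i (+ suc k)) ⟩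
    mkℚᵘ i k                              ≈⟨ toℚᵘ-grid i ⟨
    toℚᵘ (grid i)                         ∎)
    where
    open ℚᵘ.≃-Reasoning
    rescale : ∀ i d → (i * + 1) * d ≡ i * (+ 1 * d)
    rescale = solve-∀

  ∣grid-grid∣≤1⇔Near : ∀ i j → ℚ.∣ grid i ℚ.- grid j ∣ ℚ.≤ 1ℚ ⇔ Near (suc k) i j
  ∣grid-grid∣≤1⇔Near i j = ⇔.trans (mk⇔
    (λ ≤1 → ℤ.drop‿+≤+ (grid-cancel-≤ (subst₂ ℚ._≤_ ∣gi-gj∣≡ (sym grid-K≡1) ≤1)))
    (λ ≤K → subst₂ ℚ._≤_ (sym ∣gi-gj∣≡) grid-K≡1 (grid-mono-≤ (ℤ.+≤+ ≤K))))
    (∣-∣≤⇔Near (suc k) i j)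
    where
    ∣gi-gj∣≡ : ℚ.∣ grid i ℚ.- grid j ∣ ≡ grid (+ ℤ.∣ i - j ∣)
    ∣gi-gj∣≡ = trans (cong ℚ.∣_∣ (grid-homo-sub i j)) (∣grid∣ (i - j))


pred[i]<i : ∀ i → pred i ℤ.< i
pred[i]<i i = ℤ.i≤pred[j]⇒i<j ℤ.≤-refl

¬¬-∀-Fin : ∀ {n} {P : Fin n → Set} → (∀ i → ¬ ¬ P i) → ¬ ¬ (∀ i → P i)
¬¬-∀-Fin {zero}  _   ¬all = ¬all (λ ())
¬¬-∀-Fin {suc n} ¬¬P ¬all =
  ¬¬P Fin.zero (λ p₀ → ¬¬-∀-Fin (λ i → ¬¬P (Fin.suc i)) (λ pₛ → ¬all (∀-cons p₀ pₛ)))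

AboveLB-mono : ∀ {b x y} → AboveLB b x → x ℚ.≤ y → AboveLB b y
AboveLB-mono {nothing} _   _   = _
AboveLB-mono {just _}  b≤x x≤y = ℚ.≤-trans b≤x x≤y

module GridRepresentations {n : ℕ} (G : Graph n) {_≺_ : Fin n → Fin n → Set}
         (adm : AdmissibleOrder G _≺_) (lbound : Fin n → Maybe ℚ) (k : ℕ) where

  open import Data.Integer.Base using (_≤_; _<_)

  open Grid k
  open AdmissibleOrder adm
  open IsStrictPartialOrder isSPO using (irrefl)

  K : ℕ
  K = suc k

  Rep : (Fin n → ℚ) → Set
  Rep = InRep G _≺_ lbound K

  -- Membership in Rep of grid ∘ X, with |ℓ u - ℓ v| ≤ 1 read as |X u - X v| ≤ K.
  record IsGridRep (X : Fin n → ℤ) : Set where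
    field
      edge⇔near : ∀ u v → u ≢ v → E G u v ⇔ Near K (X u) (X v)
      ordered   : ∀ {u v} → u ≺ v → X u < X v
      aboveLB   : ∀ v → AboveLB (lbound v) (grid (X v))

  ∣-∣≤1⇔Near : ∀ {p q} i j → p ≡ grid i → q ≡ grid j → ℚ.∣ p ℚ.- q ∣ ℚ.≤ 1ℚ ⇔ Near K i j
  ∣-∣≤1⇔Near i j refl refl = ∣grid-grid∣≤1⇔Near i j

  InRep⇒IsGridRep : ∀ {ℓ} → Rep ℓ →
                    ∃[ X ] (∀ v → ℓ v ≡ grid (X v)) × IsGridRep X
  InRep⇒IsGridRep {ℓ} (unit , onGrid , ordered , aboveLB) = X , ℓ≡grid∘X , record
    { edge⇔near = λ u v u≢v → ⇔.trans (unit u v u≢v) (∣-∣≤1⇔Near (X u) (X v) (ℓ≡grid∘X u) (ℓ≡grid∘X v))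
    ; ordered   = λ {u} {v} u≺v → grid-cancel-< (subst₂ ℚ._<_ (ℓ≡grid∘X u) (ℓ≡grid∘X v) (ordered u v u≺v))
    ; aboveLB   = λ v → subst (AboveLB (lbound v)) (ℓ≡grid∘X v) (aboveLB v)
    }
    where
    X : Fin n → ℤ
    X v = proj₁ (onGrid v)
    ℓ≡grid∘X : ∀ v → ℓ v ≡ grid (X v)
    ℓ≡grid∘X v = trans (proj₂ (onGrid v)) (ε-multiple≡grid (X v))

  IsGridRep⇒InRep : ∀ {ℓ X} → (∀ v → ℓ v ≡ grid (X v)) → IsGridRep X → Rep ℓ
  IsGridRep⇒InRep {ℓ} {X} ℓ≡grid∘X rep =
      (λ u v u≢v → ⇔.trans (edge⇔near u v u≢v) (⇔.sym (∣-∣≤1⇔Near (X u) (X v) (ℓ≡grid∘X u) (ℓ≡grid∘X v))))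
    , (λ v → X v , trans (ℓ≡grid∘X v) (sym (ε-multiple≡grid (X v))))
    , (λ u v u≺v → subst₂ ℚ._<_ (sym (ℓ≡grid∘X u)) (sym (ℓ≡grid∘X v)) (grid-mono-< (ordered u≺v)))
    , (λ v → subst (AboveLB (lbound v)) (sym (ℓ≡grid∘X v)) (aboveLB v))
    where open IsGridRep rep

  Shiftable : (Fin n → ℚ) → Set
  Shiftable ℓ = ∃[ u ] Rep (shiftLeft K ℓ u)

  lower : (Fin n → ℤ) → Fin n → Fin n → ℤ
  lower X u v with v ≟ u
  ... | yes _ = pred (X u)
  ... | no  _ = X v

  lower-self : ∀ X u → lower X u u ≡ pred (X u)
  lower-self X u with u ≟ u
  ... | yes _   = refl
  ... | no  u≢u = contradiction refl u≢u

  shiftLeft≡grid∘lower : ∀ {ℓ X} → (∀ v → ℓ v ≡ grid (X v)) →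
                         ∀ u v → shiftLeft K ℓ u v ≡ grid (lower X u v)
  shiftLeft≡grid∘lower {ℓ} {X} ℓ≡grid∘X u v with v ≟ u
  ... | no  _ = ℓ≡grid∘X v
  ... | yes _ = begin
    ℓ u ℚ.- ε K                ≡⟨ cong (ℚ._- ε K) (ℓ≡grid∘X u) ⟩
    grid (X u) ℚ.- grid (+ 1)  ≡⟨ grid-homo-sub (X u) (+ 1) ⟩
    grid (X u - + 1)           ≡⟨ cong grid (ℤ.+-comm (X u) (- + 1)) ⟩
    grid (pred (X u))          ∎
    where open ≡-Reasoning

  data Blocks (X : Fin n → ℤ) (u w : Fin n) : Set where
    edge-breaks : E G u w → X w ≡ X u + + K → Blocks X u w
    collides    : w ≺ u → X w ≡ pred (X u) → Blocks X u w
    edge-forms  : X w + + K ≡ pred (X u) → Blocks X u w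

  Blocked : (Fin n → ℤ) → Fin n → Set
  Blocked X u = ∃[ w ] Blocks X u w

  blocks⇒jump : ∀ {X u w} → Blocks X u w → Jump K (X u) (X w)
  blocks⇒jump (edge-breaks _ eq) = up eq
  blocks⇒jump (collides _ eq)    = down eq
  blocks⇒jump (edge-forms eq)    = leap eq

  nonadjacent⇒comparable : ∀ {u v} → u ≢ v → ¬ E G u v → u ≺ v ⊎ v ≺ u
  nonadjacent⇒comparable {u} {v} u≢v ¬uv = Equivalence.from (comparable u v u≢v) indistinguishable⇒adjacent
    where
    indistinguishable⇒adjacent : ¬ Indistinguishable G u v
    indistinguishable⇒adjacent same with Equivalence.to (same u) (inj₁ refl)
    ... | inj₁ u≡v = u≢v u≡v
    ... | inj₂ vu  = ¬uv (Graph.sym G vu)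

  edge-forms⇒below : ∀ {X u w} → IsGridRep X → X w + + K ≡ pred (X u) →
                     u ≢ w × ¬ E G u w × w ≺ u
  edge-forms⇒below {X} {u} {w} rep eq = u≢w , ¬uw , w≺u
    where
    open IsGridRep rep
    Xw+K<Xu : X w + + K < X u
    Xw+K<Xu = subst (_< X u) (sym eq) (pred[i]<i (X u))
    Xw<Xu : X w < X u
    Xw<Xu = ℤ.≤-<-trans (ℤ.i≤i+j (X w) (+ K)) Xw+K<Xu
    u≢w : u ≢ w
    u≢w refl = ℤ.<-irrefl refl Xw<Xu
    ¬uw : ¬ E G u w
    ¬uw uw = ℤ.<⇒≱ Xw+K<Xu (proj₁ (Equivalence.to (edge⇔near u w u≢w) uw))
    w≺u : w ≺ u
    w≺u with nonadjacent⇒comparable u≢w ¬uw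
    ... | inj₁ u≺w = contradiction (ordered u≺w) (ℤ.<-asym Xw<Xu)
    ... | inj₂ w≺u = w≺u

  blocker-lags : ∀ {X Y u w} → IsGridRep X → IsGridRep Y → Y u < X u → Blocks X u w → Y w < X w
  blocker-lags {X} {Y} {u} {w} _ repY Yu<Xu (edge-breaks uw eq) = begin-strict
    Y w        ≤⟨ proj₂ (Equivalence.to (Y.edge⇔near u w u≢w) uw) ⟩
    Y u + + K  <⟨ ℤ.+-monoˡ-< (+ K) Yu<Xu ⟩
    X u + + K  ≡⟨ eq ⟨
    X w        ∎
    where
    module Y = IsGridRep repY
    open ℤ.≤-Reasoning
    u≢w : u ≢ w
    u≢w refl = Graph.irrefl G u uw
  blocker-lags {X} {Y} {u} {w} _ repY Yu<Xu (collides w≺u eq) = begin-strict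
    Y w        <⟨ Y.ordered w≺u ⟩
    Y u        ≤⟨ ℤ.i<j⇒i≤pred[j] Yu<Xu ⟩
    pred (X u) ≡⟨ eq ⟨
    X w        ∎
    where
    module Y = IsGridRep repY
    open ℤ.≤-Reasoning
  blocker-lags {X} {Y} {u} {w} repX repY Yu<Xu (edge-forms eq) = ℤ.≰⇒> λ Xw≤Yw → ℤ.<-irrefl refl (begin-strict
    X w + + K  ≤⟨ ℤ.+-monoˡ-≤ (+ K) Xw≤Yw ⟩
    Y w + + K  <⟨ ℤ.≰⇒> (λ Yu≤Yw+K → ¬uw (Equivalence.from (Y.edge⇔near u w u≢w) (Yu≤Yw+K , Yw≤Yu+K))) ⟩
    Y u        ≤⟨ ℤ.i<j⇒i≤pred[j] Yu<Xu ⟩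
    pred (X u) ≡⟨ eq ⟨
    X w + + K  ∎)
    where
    module Y = IsGridRep repY
    open ℤ.≤-Reasoning
    below : u ≢ w × ¬ E G u w × w ≺ u
    below = edge-forms⇒below repX eq
    u≢w : u ≢ w
    u≢w = proj₁ below
    ¬uw : ¬ E G u w
    ¬uw = proj₁ (proj₂ below)
    Yw≤Yu+K : Y w ≤ Y u + + K
    Yw≤Yu+K = ℤ.≤-trans (ℤ.<⇒≤ (Y.ordered (proj₂ (proj₂ below)))) (ℤ.i≤i+j (Y u) (+ K))

  lowered-edge : ∀ {X u w} → IsGridRep X → (∀ w → ¬ Blocks X u w) → u ≢ w →
                 E G u w ⇔ Near K (pred (X u)) (X w)
  lowered-edge {X} {u} {w} rep free u≢w = mk⇔ to′ from′
    where
    open IsGridRep rep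
    to′ : E G u w → Near K (pred (X u)) (X w)
    to′ uw = ℤ.i≤j⇒pred[i]≤j Xu≤Xw+K , (begin
      X w              ≤⟨ ℤ.i<j⇒i≤pred[j] (ℤ.≤∧≢⇒< Xw≤Xu+K (λ eq → free w (edge-breaks uw eq))) ⟩
      pred (X u + + K) ≡⟨ ℤ.pred-+ (X u) (+ K) ⟨
      pred (X u) + + K ∎)
      where
      open ℤ.≤-Reasoning
      Xu≤Xw+K : X u ≤ X w + + K
      Xu≤Xw+K = proj₁ (Equivalence.to (edge⇔near u w u≢w) uw)
      Xw≤Xu+K : X w ≤ X u + + K
      Xw≤Xu+K = proj₂ (Equivalence.to (edge⇔near u w u≢w) uw)
    from′ : Near K (pred (X u)) (X w) → E G u w
    from′ (pXu≤Xw+K , Xw≤pXu+K) = Equivalence.from (edge⇔near u w u≢w) (Xu≤Xw+K , Xw≤Xu+K)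
      where
      Xu≤Xw+K : X u ≤ X w + + K
      Xu≤Xw+K = subst (_≤ X w + + K) (ℤ.suc-pred (X u))
        (ℤ.i<j⇒suc[i]≤j (ℤ.≤∧≢⇒< pXu≤Xw+K (λ eq → free w (edge-forms (sym eq)))))
      Xw≤Xu+K : X w ≤ X u + + K
      Xw≤Xu+K = ℤ.≤-trans Xw≤pXu+K (ℤ.+-monoˡ-≤ (+ K) (ℤ.<⇒≤ (pred[i]<i (X u))))

  unblocked⇒lowerable : ∀ {X Y u} → IsGridRep X → IsGridRep Y → Y u < X u →
                        (∀ w → ¬ Blocks X u w) → IsGridRep (lower X u)
  unblocked⇒lowerable {X} {Y} {u} repX repY Yu<Xu free = record
    { edge⇔near = edge⇔near′ ; ordered = ordered′ ; aboveLB = aboveLB′ }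
    where
    open IsGridRep repX
    edge⇔near′ : ∀ v w → v ≢ w → E G v w ⇔ Near K (lower X u v) (lower X u w)
    edge⇔near′ v w v≢w with v ≟ u | w ≟ u
    ... | yes refl | yes refl = contradiction refl v≢w
    ... | yes refl | no  _    = lowered-edge repX free v≢w
    ... | no  _    | yes refl = ⇔.trans (mk⇔ (Graph.sym G) (Graph.sym G))
                                  (⇔.trans (lowered-edge repX free (λ w≡v → v≢w (sym w≡v))) (mk⇔ swap swap))
    ... | no  _    | no  _    = edge⇔near v w v≢w
    ordered′ : ∀ {v w} → v ≺ w → lower X u v < lower X u w
    ordered′ {v} {w} v≺w with v ≟ u | w ≟ u
    ... | yes refl | yes refl = contradiction v≺w (irrefl refl)
    ... | yes refl | no  _    = ℤ.<-trans (pred[i]<i (X u)) (ordered v≺w)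
    ... | no  _    | yes refl = ℤ.≤∧≢⇒< (ℤ.i<j⇒i≤pred[j] (ordered v≺w)) (λ eq → free v (collides v≺w eq))
    ... | no  _    | no  _    = ordered v≺w
    aboveLB′ : ∀ v → AboveLB (lbound v) (grid (lower X u v))
    aboveLB′ v with v ≟ u
    ... | yes refl = AboveLB-mono (IsGridRep.aboveLB repY u) (grid-mono-≤ (ℤ.i<j⇒i≤pred[j] Yu<Xu))
    ... | no  _    = aboveLB v

  lagging-choice⇒⊥ : ∀ {X Y} → n ℕ.≤ K → IsGridRep X → IsGridRep Y →
                     (∀ u → Y u < X u → Blocked X u) → ∀ {v} → ¬ (Y v < X v)
  lagging-choice⇒⊥ {X} {Y} n≤K repX repY choice Yv<Xv =
    no-cycle (successor-closed⇒short-cycle next Yv<Xv)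
    where
    next : ∀ {u} → Y u < X u → ∃[ w ] Blocks X u w × Y w < X w
    next {u} Yu<Xu = let w , b = choice u Yu<Xu in w , b , blocker-lags repX repY Yu<Xu b
    no-cycle : ¬ (∃[ s ] ∃[ L ] 0 ℕ.< L × L ℕ.≤ n × Walk (Blocks X) L s s)
    no-cycle (_ , L , 0<L , L≤n , cycle) =
      ℕ.<⇒≱ (jump-cycle-long 0<L (Walk-map X blocks⇒jump cycle)) (ℕ.≤-trans L≤n n≤K)

  -- Adjacency and the order are not decidable, so blockers cannot be searched for; a choice of
  -- them is only available under double negation, which is enough to refute a lagging vertex.
  unshiftable⇒below : n ℕ.≤ K → ∀ {ℓ X Y} → (∀ v → ℓ v ≡ grid (X v)) → IsGridRep X → IsGridRep Y →
                      ¬ Shiftable ℓ → ∀ v → X v ≤ Y v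
  unshiftable⇒below n≤K {ℓ} {X} {Y} ℓ≡grid∘X repX repY stuck v = ℤ.≮⇒≥ λ Yv<Xv →
    ¬¬-∀-Fin blocked (λ choice → lagging-choice⇒⊥ n≤K repX repY choice Yv<Xv)
    where
    lagging⇒blocked : ∀ {u} → Y u < X u → ¬ ¬ Blocked X u
    lagging⇒blocked {u} Yu<Xu unblocked = stuck (u , IsGridRep⇒InRep (shiftLeft≡grid∘lower ℓ≡grid∘X u)
      (unblocked⇒lowerable repX repY Yu<Xu (λ w b → unblocked (w , b))))
    blocked : ∀ u → ¬ ¬ (Y u < X u → Blocked X u)
    blocked u ¬choice = ¬choice (λ Yu<Xu → contradiction (λ b → ¬choice (λ _ → b)) (lagging⇒blocked Yu<Xu))

  unshiftable⇒leftmost : n ℕ.≤ K → ∀ {ℓ} → Rep ℓ → ¬ Shiftable ℓ → IsLeftmost G _≺_ lbound K ℓ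
  unshiftable⇒leftmost n≤K {ℓ} ℓ∈Rep stuck = ℓ∈Rep , least (InRep⇒IsGridRep ℓ∈Rep)
    where
    least : ∃[ X ] (∀ v → ℓ v ≡ grid (X v)) × IsGridRep X → ∀ ℓ′ → Rep ℓ′ → ℓ ≤R ℓ′
    least (X , ℓ≡grid∘X , repX) ℓ′ ℓ′∈Rep v with InRep⇒IsGridRep ℓ′∈Rep
    ... | Y , ℓ′≡grid∘Y , repY = subst₂ ℚ._≤_ (sym (ℓ≡grid∘X v)) (sym (ℓ′≡grid∘Y v))
      (grid-mono-≤ (unshiftable⇒below n≤K ℓ≡grid∘X repX repY stuck v))

  leftmost⇒unshiftable : ∀ {ℓ} → IsLeftmost G _≺_ lbound K ℓ → ¬ Shiftable ℓ
  leftmost⇒unshiftable {ℓ} (ℓ∈Rep , least) (u , shifted∈Rep) = lowered-below (InRep⇒IsGridRep ℓ∈Rep)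
    where
    lowered-below : ¬ (∃[ X ] (∀ v → ℓ v ≡ grid (X v)) × IsGridRep X)
    lowered-below (X , ℓ≡grid∘X , _) = ℤ.<-irrefl refl (ℤ.≤-<-trans Xu≤pred[Xu] (pred[i]<i (X u)))
      where
      Xu≤pred[Xu] : X u ≤ pred (X u)
      Xu≤pred[Xu] = grid-cancel-≤ (subst₂ ℚ._≤_ (ℓ≡grid∘X u)
        (trans (shiftLeft≡grid∘lower ℓ≡grid∘X u u) (cong grid (lower-self X u)))
        (least _ shifted∈Rep u))

open import Data.Nat.Base using (_≤_)

mainTheorem5 : ∀ {n : ℕ} (G : Graph n) → Connected G →
  (lbound : Fin n → Maybe ℚ) → (∃[ v ] ∃[ b ] lbound v ≡ just b) →
  (K : ℕ) → .{{_ : NonZero K}} → n ≤ K →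
  (_≺_ : Fin n → Fin n → Set) → AdmissibleOrder G _≺_ →
  (ℓ : Fin n → ℚ) → InRep G _≺_ lbound K ℓ →
  (IsLeftmost G _≺_ lbound K ℓ ⇔ (¬ (∃[ u ] InRep G _≺_ lbound K (shiftLeft K ℓ u))))
mainTheorem5 _ _ _ _ zero {{()}}
mainTheorem5 G _ lbound _ (suc k) n≤K _ adm _ ℓ∈Rep =
  mk⇔ leftmost⇒unshiftable (unshiftable⇒leftmost n≤K ℓ∈Rep)
  where open GridRepresentations G adm lbound k
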